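{- The set $\mathscr{W}$ of all Dyck words on the alphabet $\{x,D\}$ and the set $\mathscr{M}_W$ of all Dyck matrices are in bijection.
   Context: A Dyck word on the alphabet $\{x,D\}$ is a finite string over $\{x,D\}$ containing the same number of $x$'s and $D$'s, and such that in every initial segment of the string the number of $x$'s is greater than or equal to the number of $D$'s. $\mathscr{W}$ denotes the set of all such words. A Dyck matrix is a non-empty binary matrix $M=(m_{i,j})$ of size $n\times k$ (with $n,k\ge 1$) satisfying: (M1) there exists $h$ with $0<h\le k$ such that $m_{1,j}=1$ if and only if $j\le h$; (M2) for each $1\le i<n$ there exist indices $1\le a_i\le b_i<c_i\le k$ such that $a_i$ is the smallest index with $m_{i,a_i}=1$ and $m_{i+1,a_i}=0$, $b_i$ is the greatest index with $m_{i,b_i}=1$, and $c_i$ is the greatest index with $m_{i+1,c_i}=1$; and moreover: $m_{i+1,j}=m_{i,j}$ for $j=1,\dots,a_i-1$; $m_{i+1,j}=0$ for $j=a_i,\dots,b_i$; $m_{i+1,j}=1$ for $j=b_i+1,\dots,c_i$; and $m_{i+1,j}=0$ for $j=c_i+1,\dots,k$. $\mathscr{M}_W$ denotes the set of all Dyck matrices (of all sizes). -}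

module Defs where

open import Data.Nat using (ℕ; zero; suc; _≤_; _<_)
open import Data.Bool using (Bool; true; false)
open import Data.List using (List; []; _∷_; take; length)
open import Data.Vec using (Vec; []; _∷_; lookup)
open import Data.Fin using (Fin; toℕ)
open import Data.Product using (Σ; Σ-syntax; _×_; proj₁; _,_)
open import Relation.Binary.PropositionalEquality using (_≡_)
open import Relation.Nullary using (¬_)
open import Data.Unit using (⊤)

data Letter : Set where
  x D : Letter

Word : Set
Word = List Letter

#x : Word → ℕ
#x [] = 0
#x (x ∷ w) = suc (#x w)
#x (D ∷ w) = #x w

#D : Word → ℕ
#D [] = 0
#D (x ∷ w) = #D w
#D (D ∷ w) = suc (#D w)

IsDyckWord : Word → Set
IsDyckWord w = (#x w ≡ #D w) × (∀ (m : ℕ) → #D (take m w) ≤ #x (take m w))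

DyckWord : Set
DyckWord = Σ Word IsDyckWord

-- Dyck matrices.  Indices are 0-based (Fin); paper index j corresponds
-- to Fin element with toℕ = j - 1.

Row : ℕ → Set
Row k = Vec Bool k

FirstRowOK : ∀ {k} → Row k → Set
FirstRowOK {k} r =
  Σ[ h ∈ ℕ ] (0 < h) × (h ≤ k) ×
    (∀ (j : Fin k) → (lookup r j ≡ true → toℕ j < h) × (toℕ j < h → lookup r j ≡ true))

StepOK : ∀ {k} → Row k → Row k → Set
StepOK {k} r s =
  Σ[ a ∈ Fin k ] Σ[ b ∈ Fin k ] Σ[ c ∈ Fin k ]
    (toℕ a ≤ toℕ b) × (toℕ b < toℕ c) ×
    (lookup r a ≡ true) × (lookup s a ≡ false) ×
    (∀ (j : Fin k) → toℕ j < toℕ a → ¬ ((lookup r j ≡ true) × (lookup s j ≡ false))) ×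
    (lookup r b ≡ true) × (∀ (j : Fin k) → toℕ b < toℕ j → lookup r j ≡ false) ×
    (lookup s c ≡ true) × (∀ (j : Fin k) → toℕ c < toℕ j → lookup s j ≡ false) ×
    (∀ (j : Fin k) → toℕ j < toℕ a → lookup s j ≡ lookup r j) ×
    (∀ (j : Fin k) → toℕ a ≤ toℕ j → toℕ j ≤ toℕ b → lookup s j ≡ false) ×
    (∀ (j : Fin k) → toℕ b < toℕ j → toℕ j ≤ toℕ c → lookup s j ≡ true) ×
    (∀ (j : Fin k) → toℕ c < toℕ j → lookup s j ≡ false)

AllSteps : ∀ {k n} → Vec (Row k) n → Set
AllSteps [] = ⊤
AllSteps (r ∷ []) = ⊤
AllSteps (r ∷ s ∷ rs) = StepOK r s × AllSteps (s ∷ rs)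

RawMatrix : Set
RawMatrix = Σ[ n ∈ ℕ ] Σ[ k ∈ ℕ ] Vec (Row (suc k)) (suc n)

IsDyckMatrix : RawMatrix → Set
IsDyckMatrix (n , k , (r ∷ rs)) =
  FirstRowOK r × AllSteps (r ∷ rs)

DyckMatrix : Set
DyckMatrix = Σ RawMatrix IsDyckMatrix

module Submission where

-- Number the letters x of a Dyck word 0, 1, 2, … from the left and cut the word into runs
-- x^(m₀+1) D^(d₀+1) x^(m₁+1) D^(d₁+1) …. After the i-th x-run the unmatched x's form a stack of
-- column indices, and row i of the matrix is the indicator of that stack: the first row is
-- 1^h 0…0 (M1), and between consecutive rows the D-run pops the stack down to and including
-- some column a, after which the next x-run pushes the new columns b + 1, …, c, where b is the
-- top of the stack (M2). Conversely a and c are determined by two consecutive rows, and the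
-- number of entries of the stack above a is the length of the D-run minus one, so the runs,
-- and with them the word, can be read off the matrix.
--
-- This matches the non-empty Dyck words with the Dyck matrices whose last column is not zero.
-- A Dyck matrix may however end with any number t of zero columns: Cantor's pairing
-- ℕ × ℕ ≅ ℕ absorbs t into the length of the last x-run, and for single-row matrices it
-- matches (m + 1 ones, then t zeros) with the words x^n D^n, n ≥ 0, the empty word included.

open import Defs
open import Data.Product using (Σ-syntax; _×_; proj₁)
open import Relation.Binary.PropositionalEquality using (_≡_)

open import Data.Bool using (true; false)
open import Data.Bool.Properties using (¬-not)
open import Data.Empty using (⊥)
open import Data.Fin using (Fin; toℕ; fromℕ<)
open import Data.Fin.Properties using (toℕ-fromℕ<; toℕ<n)
open import Data.List using (List; []; _∷_; _++_; applyDownFrom; drop; filter; length; replicate; take)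
open import Data.List.Properties
  using (++-identityʳ; filter-++; filter-all; filter-none; length-++; length-applyDownFrom; length-drop)
open import Data.List.Membership.Propositional.Properties
  using (∈-∃++; ∈-++⁺ˡ; ∈-++⁺ʳ; ∈-++⁻; ∈-applyDownFrom⁺; ∈-applyDownFrom⁻)
open import Data.List.Relation.Unary.All as All using (All; []; _∷_)
import Data.List.Relation.Unary.All.Properties as All
open import Data.List.Relation.Unary.AllPairs using (AllPairs; []; _∷_)
import Data.List.Relation.Unary.AllPairs.Properties as AllPairs
open import Data.List.Relation.Unary.Any using (here; there)
open import Data.Maybe using (Maybe; nothing; just)
open import Data.Nat
  using (ℕ; zero; suc; pred; _+_; _∸_; _≤_; _<_; _>_; _≤?_; _<?_; z≤n; s≤s; s≤s⁻¹)
open import Data.Nat.Properties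
open import Data.List.Membership.DecPropositional _≟_ using (_∈_; _∉_; _∈?_)
open import Data.Product using (Σ; ∃; ∃₂; _,_; proj₂; map₁; uncurry)
open import Data.Sum as Sum using (_⊎_; inj₁; inj₂)
open import Data.Unit using (⊤; tt)
open import Data.Vec using (Vec; []; _∷_; head; lookup; tabulate)
open import Data.Vec.Properties using (lookup∘tabulate; tabulate∘lookup; tabulate-cong)
open import Function using (_⇔_; mk⇔; _∘_; Equivalence)
open import Relation.Binary.PropositionalEquality
  using (_≢_; refl; sym; trans; cong; cong₂; subst; subst₂; module ≡-Reasoning)
open import Relation.Nullary using (¬_; does; yes; no; contradiction)
open import Relation.Nullary.Decidable using (dec-true; dec-false; does-⇔; decidable-stable)

-- Dyck words as runs

DyckFrom : ℕ → Word → Set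
DyckFrom h [] = h ≡ 0
DyckFrom h (x ∷ w) = DyckFrom (suc h) w
DyckFrom zero (D ∷ w) = ⊥
DyckFrom (suc h) (D ∷ w) = DyckFrom h w

-- IsDyckWord is Balanced 0.
Balanced : ℕ → Word → Set
Balanced h w = (h + #x w ≡ #D w) × (∀ m → #D (take m w) ≤ h + #x (take m w))

dyckFrom⇒balanced : ∀ h w → DyckFrom h w → Balanced h w
dyckFrom⇒balanced h [] h≡0 = trans (+-identityʳ h) h≡0 , λ { zero → z≤n ; (suc m) → z≤n }
dyckFrom⇒balanced h (x ∷ w) p with dyckFrom⇒balanced (suc h) w p
... | total , prefix = trans (+-suc h (#x w)) total ,
      λ { zero → z≤n ; (suc m) → ≤-trans (prefix m) (≤-reflexive (sym (+-suc h _))) }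
dyckFrom⇒balanced (suc h) (D ∷ w) p with dyckFrom⇒balanced h w p
... | total , prefix = cong suc total , λ { zero → z≤n ; (suc m) → s≤s (prefix m) }

balanced⇒dyckFrom : ∀ h w → Balanced h w → DyckFrom h w
balanced⇒dyckFrom h [] (total , _) = trans (sym (+-identityʳ h)) total
balanced⇒dyckFrom h (x ∷ w) (total , prefix) =
  balanced⇒dyckFrom (suc h) w (trans (sym (+-suc h (#x w))) total ,
                               λ m → ≤-trans (prefix (suc m)) (≤-reflexive (+-suc h _)))
balanced⇒dyckFrom zero (D ∷ w) (_ , prefix) with prefix 1
... | ()
balanced⇒dyckFrom (suc h) (D ∷ w) (total , prefix) =
  balanced⇒dyckFrom h w (suc-injective total , λ m → s≤s⁻¹ (prefix (suc m)))

-- ((m₀ , d₀) ∷ … ∷ (mₖ , dₖ) ∷ [] , m) stands for x^(m₀+1) D^(d₀+1) … x^(mₖ+1) D^(dₖ+1) x^(m+1) D^e,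
-- whose last run D^e returns to height 0; ValidRuns h: no D-run goes below 0 from height h.
Runs : Set
Runs = List (ℕ × ℕ) × ℕ

runsWord : ℕ → Runs → Word
runsWord h ([] , m) = replicate (suc m) x ++ replicate (suc m + h) D
runsWord h ((m , d) ∷ L , m′) =
  replicate (suc m) x ++ replicate (suc d) D ++ runsWord (suc m + h ∸ suc d) (L , m′)

ValidRuns : ℕ → List (ℕ × ℕ) → Set
ValidRuns h [] = ⊤
ValidRuns h ((m , d) ∷ L) = d < suc m + h × ValidRuns (suc m + h ∸ suc d) L

dyckFrom-xs : ∀ n {h} w → DyckFrom (n + h) w → DyckFrom h (replicate n x ++ w)
dyckFrom-xs zero w p = p
dyckFrom-xs (suc n) {h} w p = dyckFrom-xs n w (subst (λ k → DyckFrom k w) (sym (+-suc n h)) p)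

dyckFrom-Ds : ∀ n {h} w → n ≤ h → DyckFrom (h ∸ n) w → DyckFrom h (replicate n D ++ w)
dyckFrom-Ds zero w _ p = p
dyckFrom-Ds (suc n) w (s≤s n≤h) p = dyckFrom-Ds n w n≤h p

dyckFrom-replicate-D : ∀ n → DyckFrom n (replicate n D)
dyckFrom-replicate-D zero = refl
dyckFrom-replicate-D (suc n) = dyckFrom-replicate-D n

runsWord-dyckFrom : ∀ h L m → ValidRuns h L → DyckFrom h (runsWord h (L , m))
runsWord-dyckFrom h [] m _ = dyckFrom-xs (suc m) _ (dyckFrom-replicate-D (suc m + h))
runsWord-dyckFrom h ((m , d) ∷ L) m′ (d<h , valid) =
  dyckFrom-xs (suc m) _ (dyckFrom-Ds (suc d) _ d<h (runsWord-dyckFrom _ L m′ valid))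

runsWord-x∷ : ∀ h r → runsWord h r ≡ x ∷ drop 1 (runsWord h r)
runsWord-x∷ h ([] , m) = refl
runsWord-x∷ h (_ ∷ _ , m) = refl

-- parseRise h m w : the current x-run, started at height h, has m + 1 letters so far;
-- parseFall h m d w : it has been followed by d + 1 letters D.
mutual
  parseRise : ℕ → ℕ → Word → Runs
  parseRise h m [] = [] , m
  parseRise h m (x ∷ w) = parseRise h (suc m) w
  parseRise h m (D ∷ w) = parseFall h m 0 w

  parseFall : ℕ → ℕ → ℕ → Word → Runs
  parseFall h m d [] = [] , m
  parseFall h m d (D ∷ w) = parseFall h m (suc d) w
  parseFall h m d (x ∷ w) = map₁ ((m , d) ∷_) (parseRise (suc m + h ∸ suc d) 0 w)

ParsesTo : ℕ → Runs → Word → Set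
ParsesTo h r w = ValidRuns h (proj₁ r) × runsWord h r ≡ w

replicate-∷ʳ : ∀ {A : Set} (a : A) n w → replicate n a ++ a ∷ w ≡ a ∷ replicate n a ++ w
replicate-∷ʳ a zero w = refl
replicate-∷ʳ a (suc n) w = cong (a ∷_) (replicate-∷ʳ a n w)

fall-step : ∀ h d w → DyckFrom (h ∸ suc d) (D ∷ w) →
            suc d < h × DyckFrom (h ∸ suc (suc d)) w
fall-step h d w p with h ∸ suc d in eq
fall-step h d w () | zero
fall-step h d w p  | suc k = m∸n≢0⇒n<m (λ h∸sd≡0 → 0≢1+n (trans (sym h∸sd≡0) eq)) ,
              subst (λ k → DyckFrom k w) (trans (cong pred (sym eq)) (pred[m∸n]≡m∸[1+n] h (suc d))) p

mutual
  parseRise-sound : ∀ h m w → DyckFrom (suc m + h) w →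
                    ParsesTo h (parseRise h m w) (replicate (suc m) x ++ w)
  parseRise-sound h m (x ∷ w) p with parseRise-sound h (suc m) w p
  ... | valid , word = valid , trans word (sym (replicate-∷ʳ x (suc m) w))
  parseRise-sound h m (D ∷ w) p = parseFall-sound h m 0 w (s≤s z≤n) p

  parseFall-sound : ∀ h m d w → d < suc m + h → DyckFrom (suc m + h ∸ suc d) w →
                    ParsesTo h (parseFall h m d w) (replicate (suc m) x ++ replicate (suc d) D ++ w)
  parseFall-sound h m d [] d<h p =
    tt , cong (replicate (suc m) x ++_)
              (trans (cong (λ n → replicate n D) (sym (≤-antisym d<h (m∸n≡0⇒m≤n p))))
                     (sym (++-identityʳ _)))
  parseFall-sound h m d (D ∷ w) d<h p with fall-step (suc m + h) d w p
  ... | sd<h , p′ with parseFall-sound h m (suc d) w sd<h p′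
  ...   | valid , word =
    valid , trans word (cong (replicate (suc m) x ++_) (sym (replicate-∷ʳ D (suc d) w)))
  parseFall-sound h m d (x ∷ w) d<h p with parseRise-sound (suc m + h ∸ suc d) 0 w p
  ... | valid , word =
    (d<h , valid) , cong (λ v → replicate (suc m) x ++ replicate (suc d) D ++ v) word

parseRise-xs : ∀ h m n w → parseRise h m (replicate n x ++ w) ≡ parseRise h (m + n) w
parseRise-xs h m zero w = cong (λ k → parseRise h k w) (sym (+-identityʳ m))
parseRise-xs h m (suc n) w =
  trans (parseRise-xs h (suc m) n w) (cong (λ k → parseRise h k w) (sym (+-suc m n)))

parseFall-Ds : ∀ h m d n w → parseFall h m d (replicate n D ++ w) ≡ parseFall h m (d + n) w
parseFall-Ds h m d zero w = cong (λ k → parseFall h m k w) (sym (+-identityʳ d))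
parseFall-Ds h m d (suc n) w =
  trans (parseFall-Ds h m (suc d) n w) (cong (λ k → parseFall h m k w) (sym (+-suc d n)))

parseFall-end : ∀ h m d n → parseFall h m d (replicate n D) ≡ ([] , m)
parseFall-end h m d zero = refl
parseFall-end h m d (suc n) = parseFall-end h m (suc d) n

parseRise-runsWord : ∀ h r → parseRise h 0 (drop 1 (runsWord h r)) ≡ r
parseRise-runsWord h ([] , m) = trans (parseRise-xs h 0 m _) (parseFall-end h m 0 (m + h))
parseRise-runsWord h ((m , d) ∷ L , m′) = begin
  parseRise h 0 (replicate m x ++ replicate (suc d) D ++ rest)
    ≡⟨ parseRise-xs h 0 m _ ⟩
  parseFall h m 0 (replicate d D ++ rest)
    ≡⟨ parseFall-Ds h m 0 d rest ⟩
  parseFall h m d rest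
    ≡⟨ cong (parseFall h m d) (runsWord-x∷ h′ (L , m′)) ⟩
  map₁ ((m , d) ∷_) (parseRise h′ 0 (drop 1 rest))
    ≡⟨ cong (map₁ ((m , d) ∷_)) (parseRise-runsWord h′ (L , m′)) ⟩
  ((m , d) ∷ L , m′) ∎
  where
  open ≡-Reasoning
  h′ = suc m + h ∸ suc d
  rest = runsWord h′ (L , m′)

parse : Word → Maybe Runs
parse (x ∷ w) = just (parseRise 0 0 w)
parse _ = nothing

wordOf : Maybe Runs → Word
wordOf nothing = []
wordOf (just r) = runsWord 0 r

ValidCode : Maybe Runs → Set
ValidCode nothing = ⊤
ValidCode (just (L , _)) = ValidRuns 0 L

parse-sound : ∀ w → DyckFrom 0 w → ValidCode (parse w) × wordOf (parse w) ≡ w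
parse-sound [] _ = tt , refl
parse-sound (x ∷ w) p = parseRise-sound 0 0 w p

parse-wordOf : ∀ c → parse (wordOf c) ≡ c
parse-wordOf nothing = refl
parse-wordOf (just r) = trans (cong parse (runsWord-x∷ 0 r)) (cong just (parseRise-runsWord 0 r))

wordOf-dyckFrom : ∀ c → ValidCode c → DyckFrom 0 (wordOf c)
wordOf-dyckFrom nothing _ = refl
wordOf-dyckFrom (just (L , m)) valid = runsWord-dyckFrom 0 L m valid

-- Cantor pairing and trailing zero columns

triangle : ℕ → ℕ
triangle zero = zero
triangle (suc n) = suc n + triangle n

pair : ℕ → ℕ → ℕ
pair a b = triangle (a + b) + a

-- Cantor's enumeration of ℕ × ℕ runs through the diagonals a + b = s in order of a.
cantor-suc : ℕ × ℕ → ℕ × ℕ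
cantor-suc (a , suc b) = suc a , b
cantor-suc (a , zero) = zero , suc a

unpair : ℕ → ℕ × ℕ
unpair zero = 0 , 0
unpair (suc n) = cantor-suc (unpair n)

pair-cantor-suc : ∀ p → uncurry pair (cantor-suc p) ≡ suc (uncurry pair p)
pair-cantor-suc (a , suc b) = begin
  triangle (suc a + b) + suc a   ≡⟨ +-suc _ a ⟩
  suc (triangle (suc a + b) + a) ≡⟨ cong (λ s → suc (triangle s + a)) (sym (+-suc a b)) ⟩
  suc (triangle (a + suc b) + a) ∎
  where open ≡-Reasoning
pair-cantor-suc (a , zero) = begin
  suc a + triangle a + 0     ≡⟨ +-identityʳ _ ⟩
  suc (a + triangle a)       ≡⟨ cong suc (+-comm a (triangle a)) ⟩
  suc (triangle a + a)       ≡⟨ cong (λ s → suc (triangle s + a)) (sym (+-identityʳ a)) ⟩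
  suc (triangle (a + 0) + a) ∎
  where open ≡-Reasoning

pair-unpair : ∀ n → uncurry pair (unpair n) ≡ n
pair-unpair zero = refl
pair-unpair (suc n) = trans (pair-cantor-suc (unpair n)) (cong suc (pair-unpair n))

unpair-diagonal : ∀ s a → a ≤ s → unpair (triangle s + a) ≡ (a , s ∸ a)
unpair-diagonal zero zero _ = refl
unpair-diagonal (suc s) zero _ = begin
  unpair (suc s + triangle s + 0)
    ≡⟨ cong unpair (trans (+-identityʳ _) (cong suc (+-comm s (triangle s)))) ⟩
  cantor-suc (unpair (triangle s + s))
    ≡⟨ cong cantor-suc (unpair-diagonal s s ≤-refl) ⟩
  cantor-suc (s , s ∸ s)
    ≡⟨ cong (λ b → cantor-suc (s , b)) (n∸n≡0 s) ⟩
  (0 , suc s) ∎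
  where open ≡-Reasoning
unpair-diagonal s (suc a) a<s = begin
  unpair (triangle s + suc a)
    ≡⟨ cong unpair (+-suc (triangle s) a) ⟩
  cantor-suc (unpair (triangle s + a))
    ≡⟨ cong cantor-suc (unpair-diagonal s a (<⇒≤ a<s)) ⟩
  cantor-suc (a , s ∸ a)
    ≡⟨ cong (λ b → cantor-suc (a , b)) (+-∸-assoc 1 a<s) ⟩
  (suc a , s ∸ suc a) ∎
  where open ≡-Reasoning

unpair-pair : ∀ a b → unpair (pair a b) ≡ (a , b)
unpair-pair a b = trans (unpair-diagonal (a + b) a (m≤m+n a b)) (cong (a ,_) (m+n∸m≡n a b))

attach : List (ℕ × ℕ) → ℕ × ℕ → Runs × ℕ
attach L (m , t) = (L , m) , t

singleRow : ℕ → Maybe Runs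
singleRow zero = nothing
singleRow (suc n) = just ([] , n)

unpad : Runs × ℕ → Maybe Runs
unpad (([] , m) , t) = singleRow (pair m t)
unpad ((q ∷ L , m) , t) = just (q ∷ L , pair m t)

pad : Maybe Runs → Runs × ℕ
pad nothing = attach [] (unpair 0)
pad (just ([] , n)) = attach [] (unpair (suc n))
pad (just (q ∷ L , n)) = attach (q ∷ L) (unpair n)

unpad-pad : ∀ c → unpad (pad c) ≡ c
unpad-pad nothing = refl
unpad-pad (just ([] , n)) = cong singleRow (pair-unpair (suc n))
unpad-pad (just (q ∷ L , n)) = cong (λ k → just (q ∷ L , k)) (pair-unpair n)

pad-singleRow : ∀ n → pad (singleRow n) ≡ attach [] (unpair n)
pad-singleRow zero = refl
pad-singleRow (suc n) = refl

pad-unpad : ∀ p → pad (unpad p) ≡ p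
pad-unpad (([] , m) , t) = trans (pad-singleRow (pair m t)) (cong (attach []) (unpair-pair m t))
pad-unpad ((q ∷ L , m) , t) = cong (attach (q ∷ L)) (unpair-pair m t)

ValidPadded : Runs × ℕ → Set
ValidPadded ((L , _) , _) = ValidRuns 0 L

pad-valid : ∀ c → ValidCode c → ValidPadded (pad c)
pad-valid nothing _ = tt
pad-valid (just ([] , n)) _ = tt
pad-valid (just (q ∷ L , n)) valid = valid

unpad-valid : ∀ p → ValidPadded p → ValidCode (unpad p)
unpad-valid (([] , m) , t) _ with pair m t
... | zero = tt
... | suc n = tt
unpad-valid ((q ∷ L , m) , t) valid = valid

-- Stacks of columns

Descending : List ℕ → Set
Descending = AllPairs _>_

push : ℕ → ℕ → List ℕ → List ℕ
push N m S = applyDownFrom (_+ N) (suc m) ++ S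

∈-push⇔ : ∀ {N m S j} → j ∈ push N m S ⇔ ((N ≤ j × j ≤ m + N) ⊎ j ∈ S)
∈-push⇔ {N} {m} {S} {j} = mk⇔ to from
  where
  to : j ∈ push N m S → (N ≤ j × j ≤ m + N) ⊎ j ∈ S
  to j∈ with ∈-++⁻ (applyDownFrom (_+ N) (suc m)) j∈
  ... | inj₂ j∈S = inj₂ j∈S
  ... | inj₁ j∈block with ∈-applyDownFrom⁻ (_+ N) j∈block
  ...   | i , i<sm , refl = inj₁ (m≤n+m N i , +-monoˡ-≤ N (s≤s⁻¹ i<sm))
  from : (N ≤ j × j ≤ m + N) ⊎ j ∈ S → j ∈ push N m S
  from (inj₂ j∈S) = ∈-++⁺ʳ _ j∈S
  from (inj₁ (N≤j , j≤m+N)) =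
    ∈-++⁺ˡ (subst (_∈ applyDownFrom (_+ N) (suc m)) (m∸n+n≡m N≤j)
                  (∈-applyDownFrom⁺ (_+ N) (s≤s (m≤n+o⇒m∸n≤o j N (subst (j ≤_) (+-comm m N) j≤m+N)))))

length-push : ∀ N m S → length (push N m S) ≡ suc m + length S
length-push N m S =
  trans (length-++ (applyDownFrom (_+ N) (suc m))) (cong (_+ length S) (length-applyDownFrom (_+ N) (suc m)))

push-bounded : ∀ {N} m {S} → All (_< N) S → All (_< suc m + N) (push N m S)
push-bounded {N} m S<N =
  All.++⁺ (All.applyDownFrom⁺₁ (_+ N) (suc m) (+-monoˡ-< N))
          (All.map (λ s<N → <-≤-trans s<N (m≤n+m N (suc m))) S<N)

push-top : ∀ {N} m {S} → All (_< N) S → All (_≤ m + N) (push N m S)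
push-top m S<N = All.map s≤s⁻¹ (push-bounded m S<N)

push-descending : ∀ {N} m {S} → Descending S → All (_< N) S → Descending (push N m S)
push-descending {N} m desc S<N =
  AllPairs.++⁺ (AllPairs.applyDownFrom⁺₁ (_+ N) (suc m) (λ j<i _ → +-monoˡ-< N j<i)) desc
               (All.applyDownFrom⁺₁ _ (suc m)
                  (λ {i} _ → All.map (λ s<N → <-≤-trans s<N (m≤n+m N i)) S<N))

descending-split : ∀ P {α S} → Descending (P ++ α ∷ S) → All (α <_) P × All (_< α) S
descending-split [] (S<α ∷ _) = [] , S<α
descending-split (p ∷ P) (rest<p ∷ desc) with descending-split P desc
... | P>α , S<α = All.lookup rest<p (∈-++⁺ʳ P (here refl)) ∷ P>α , S<α

∈-lower⇔ : ∀ P {α S j} → Descending (P ++ α ∷ S) → j ∈ S ⇔ (j ∈ P ++ α ∷ S × j < α)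
∈-lower⇔ P {α} {S} {j} desc = mk⇔ to from
  where
  to : j ∈ S → j ∈ P ++ α ∷ S × j < α
  to j∈S = ∈-++⁺ʳ P (there j∈S) , All.lookup (proj₂ (descending-split P desc)) j∈S
  from : j ∈ P ++ α ∷ S × j < α → j ∈ S
  from (j∈ , j<α) with ∈-++⁻ P j∈
  ... | inj₁ j∈P = contradiction (All.lookup (proj₁ (descending-split P desc)) j∈P) (<-asym j<α)
  ... | inj₂ (here refl) = contradiction j<α (<-irrefl refl)
  ... | inj₂ (there j∈S) = j∈S

#above : ℕ → List ℕ → ℕ
#above a T = length (filter (a <?_) T)

#above-split : ∀ P {α S} → Descending (P ++ α ∷ S) → #above α (P ++ α ∷ S) ≡ length P
#above-split P {α} {S} desc with descending-split P desc
... | P>α , S<α = begin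
  length (filter (α <?_) (P ++ α ∷ S))
    ≡⟨ cong length (filter-++ (α <?_) P (α ∷ S)) ⟩
  length (filter (α <?_) P ++ filter (α <?_) (α ∷ S))
    ≡⟨ cong length (cong₂ _++_ (filter-all (α <?_) P>α)
                               (filter-none (α <?_) (<-irrefl refl ∷ All.map <-asym S<α))) ⟩
  length (P ++ [])
    ≡⟨ cong length (++-identityʳ P) ⟩
  length P ∎
  where open ≡-Reasoning

drop-split : ∀ P {α : ℕ} {S} → drop (suc (length P)) (P ++ α ∷ S) ≡ S
drop-split [] = refl
drop-split (p ∷ P) = drop-split P

split-at : ∀ d (T : List ℕ) → d < length T →
           ∃₂ λ P α → T ≡ P ++ α ∷ drop (suc d) T × length P ≡ d
split-at zero (t ∷ T) _ = [] , t , refl , refl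
split-at (suc d) (t ∷ T) (s≤s d<T) with split-at d T d<T
... | P , α , T≡ , refl = t ∷ P , α , cong (t ∷_) T≡ , refl

-- Condition (M2) on stacks, with a, b, c = α, β, γ: the next stack keeps the entries of T
-- below α and adds the columns β + 1, …, γ.
NextStack : List ℕ → ℕ → ℕ → ℕ → List ℕ → Set
NextStack T α β γ S = ∀ {j} → j ∈ S ⇔ ((β < j × j ≤ γ) ⊎ (j ∈ T × j < α))

push-nextStack : ∀ {T} P {α S} β m → Descending T → T ≡ P ++ α ∷ S →
                 NextStack T α β (m + suc β) (push (suc β) m S)
push-nextStack P β m desc refl =
  mk⇔ (Sum.map₂ (Equivalence.to (∈-lower⇔ P desc)) ∘ Equivalence.to ∈-push⇔)
      (Equivalence.from ∈-push⇔ ∘ Sum.map₂ (Equivalence.from (∈-lower⇔ P desc)))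

module _ {T α β γ S} (next : NextStack T α β γ S) {j : ℕ} where

  next-below : α ≤ β → j < α → j ∈ S ⇔ j ∈ T
  next-below α≤β j<α = mk⇔ below⇒ (λ j∈T → Equivalence.from next (inj₂ (j∈T , j<α)))
    where
    below⇒ : j ∈ S → j ∈ T
    below⇒ j∈S with Equivalence.to next j∈S
    ... | inj₁ (β<j , _) = contradiction (<-trans j<α (≤-<-trans α≤β β<j)) (<-irrefl refl)
    ... | inj₂ (j∈T , _) = j∈T

  next-gap : α ≤ j → j ≤ β → j ∉ S
  next-gap α≤j j≤β j∈S with Equivalence.to next j∈S
  ... | inj₁ (β<j , _) = <⇒≱ β<j j≤β
  ... | inj₂ (_ , j<α) = <⇒≱ j<α α≤j

  next-fresh : β < j → j ≤ γ → j ∈ S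
  next-fresh β<j j≤γ = Equivalence.from next (inj₁ (β<j , j≤γ))

  next-beyond : α ≤ γ → γ < j → j ∉ S
  next-beyond α≤γ γ<j j∈S with Equivalence.to next j∈S
  ... | inj₁ (_ , j≤γ) = <⇒≱ γ<j j≤γ
  ... | inj₂ (_ , j<α) = <-asym γ<j (<-≤-trans j<α α≤γ)

nextStack-cong : ∀ {T α β γ α′ β′ γ′ S} → α ≡ α′ → β ≡ β′ → γ ≡ γ′ →
                 NextStack T α β γ S → NextStack T α′ β′ γ′ S
nextStack-cong refl refl refl next = next

pop-depth : ∀ {T d} → Descending T → d < length T →
            ∃ λ α → α ∈ T × #above α T ≡ d ×
                    (∀ β m → NextStack T α β (m + suc β) (push (suc β) m (drop (suc d) T)))
pop-depth {T} {d} desc d<T with split-at d T d<T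
... | P , α , T≡ , refl =
  α , subst (α ∈_) (sym T≡) (∈-++⁺ʳ P (here refl)) ,
  trans (cong (#above α) T≡) (#above-split P (subst Descending T≡ desc)) ,
  λ β m → push-nextStack P β m desc T≡

pop-entry : ∀ {T a} → Descending T → a ∈ T →
            #above a T < length T ×
            (∀ β m → NextStack T a β (m + suc β) (push (suc β) m (drop (suc (#above a T)) T)))
pop-entry {a = a} desc a∈T with ∈-∃++ a∈T
... | P , S , refl =
  subst₂ _<_ (sym #above≡) (sym (length-++ P)) (m<m+n (length P) (s≤s z≤n)) ,
  λ β m → subst (λ U → NextStack (P ++ a ∷ S) a β (m + suc β) (push (suc β) m U))
                (sym (trans (cong (λ n → drop (suc n) (P ++ a ∷ S)) #above≡) (drop-split P)))
                (push-nextStack P β m desc refl)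
  where
  #above≡ : #above a (P ++ a ∷ S) ≡ length P
  #above≡ = #above-split P desc

popped-stack : ∀ {N} m {S} d → Descending S → All (_< N) S →
               Descending (drop (suc d) (push N m S)) × All (_< suc m + N) (drop (suc d) (push N m S))
popped-stack m d desc S<N =
  AllPairs.drop⁺ (suc d) (push-descending m desc S<N) , All.drop⁺ (suc d) (push-bounded m S<N)

length-pop : ∀ N m S d → length (drop (suc d) (push N m S)) ≡ suc m + length S ∸ suc d
length-pop N m S d = trans (length-drop (suc d) (push N m S)) (cong (_∸ suc d) (length-push N m S))

-- Rows as indicators of stacks

true≢false : true ≢ false
true≢false ()

row : (K : ℕ) → List ℕ → Row K
row K S = tabulate (λ j → does (toℕ j ∈? S))

module _ {K : ℕ} {S : List ℕ} {j : Fin K} where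

  row-∈ : toℕ j ∈ S → lookup (row K S) j ≡ true
  row-∈ j∈S = trans (lookup∘tabulate _ j) (dec-true (toℕ j ∈? S) j∈S)

  row-∉ : toℕ j ∉ S → lookup (row K S) j ≡ false
  row-∉ j∉S = trans (lookup∘tabulate _ j) (dec-false (toℕ j ∈? S) j∉S)

  ∈-row : lookup (row K S) j ≡ true → toℕ j ∈ S
  ∈-row e = decidable-stable (toℕ j ∈? S) (λ j∉S → true≢false (trans (sym e) (row-∉ j∉S)))

  ∉-row : lookup (row K S) j ≡ false → toℕ j ∉ S
  ∉-row e j∈S = true≢false (trans (sym (row-∈ j∈S)) e)

  row-cong : ∀ {T} → (toℕ j ∈ S ⇔ toℕ j ∈ T) → lookup (row K S) j ≡ lookup (row K T) j
  row-cong {T} S⇔T =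
    trans (lookup∘tabulate _ j) (trans (does-⇔ S⇔T (toℕ j ∈? S) (toℕ j ∈? T)) (sym (lookup∘tabulate _ j)))

row-ext : ∀ {K} (s : Row K) S → (∀ j → lookup s j ≡ lookup (row K S) j) → s ≡ row K S
row-ext {K} s S s≗S =
  trans (sym (tabulate∘lookup s)) (trans (tabulate-cong s≗S) (tabulate∘lookup (row K S)))

row-∈′ : ∀ {K S n} (n<K : n < K) → n ∈ S → lookup (row K S) (fromℕ< n<K) ≡ true
row-∈′ n<K n∈S = row-∈ (subst (_∈ _) (sym (toℕ-fromℕ< n<K)) n∈S)

row-∉′ : ∀ {K S n} (n<K : n < K) → n ∉ S → lookup (row K S) (fromℕ< n<K) ≡ false
row-∉′ n<K n∉S = row-∉ (n∉S ∘ subst (_∈ _) (toℕ-fromℕ< n<K))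

<-fromℕ<ʳ : ∀ {K i n} (n<K : n < K) → i < n → i < toℕ (fromℕ< n<K)
<-fromℕ<ʳ n<K = subst (_ <_) (sym (toℕ-fromℕ< n<K))

<-fromℕ<ˡ : ∀ {K i n} (n<K : n < K) → n < i → toℕ (fromℕ< n<K) < i
<-fromℕ<ˡ n<K = subst (_< _) (sym (toℕ-fromℕ< n<K))

-- The indices a, b, c of a step; stated for Σ-types, as StepOK's row arguments cannot be
-- inferred from a proof of it.
module _ {k : ℕ} where

  a-of : ∀ {P : Fin k → Set} → Σ (Fin k) P → Fin k
  a-of = proj₁

  b-of : ∀ {P : Fin k → Fin k → Set} → Σ[ a ∈ Fin k ] Σ (Fin k) (P a) → Fin k
  b-of = proj₁ ∘ proj₂

  c-of : ∀ {P : Fin k → Fin k → Fin k → Set} →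
         Σ[ a ∈ Fin k ] Σ[ b ∈ Fin k ] Σ (Fin k) (P a b) → Fin k
  c-of = proj₁ ∘ proj₂ ∘ proj₂

rows-stepOK : ∀ {K T S} (a b c : Fin K) →
              toℕ a ∈ T → toℕ b ∈ T → All (_≤ toℕ b) T → toℕ b < toℕ c →
              NextStack T (toℕ a) (toℕ b) (toℕ c) S → StepOK (row K T) (row K S)
rows-stepOK {K} {T} {S} a b c a∈T b∈T T≤b b<c next =
  a , b , c , a≤b , b<c ,
  row-∈ a∈T , row-∉ (next-gap next ≤-refl a≤b) , a-least ,
  row-∈ b∈T , beyond-b ,
  row-∈ (next-fresh next b<c ≤-refl) , beyond-c ,
  below , gap , fresh , beyond-c
  where
  a≤b = All.lookup T≤b a∈T
  below : ∀ j → toℕ j < toℕ a → lookup (row K S) j ≡ lookup (row K T) j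
  below j j<a = row-cong (next-below next a≤b j<a)
  a-least : ∀ j → toℕ j < toℕ a → ¬ ((lookup (row K T) j ≡ true) × (lookup (row K S) j ≡ false))
  a-least j j<a (rj , sj) = true≢false (trans (sym rj) (trans (sym (below j j<a)) sj))
  beyond-b : ∀ j → toℕ b < toℕ j → lookup (row K T) j ≡ false
  beyond-b j b<j = row-∉ (λ j∈T → <⇒≱ b<j (All.lookup T≤b j∈T))
  gap : ∀ j → toℕ a ≤ toℕ j → toℕ j ≤ toℕ b → lookup (row K S) j ≡ false
  gap j a≤j j≤b = row-∉ (next-gap next a≤j j≤b)
  fresh : ∀ j → toℕ b < toℕ j → toℕ j ≤ toℕ c → lookup (row K S) j ≡ true
  fresh j b<j j≤c = row-∈ (next-fresh next b<j j≤c)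
  beyond-c : ∀ j → toℕ c < toℕ j → lookup (row K S) j ≡ false
  beyond-c j c<j = row-∉ (next-beyond next (≤-trans a≤b (<⇒≤ b<c)) c<j)

stepOK-rows : ∀ {K T S α β γ} → α ∈ T → β ∈ T → All (_≤ β) T → β < γ → γ < K →
              NextStack T α β γ S → StepOK (row K T) (row K S)
stepOK-rows {K} {T} {S} {α} {β} {γ} α∈T β∈T T≤β β<γ γ<K next =
  rows-stepOK (fromℕ< α<K) (fromℕ< β<K) (fromℕ< γ<K)
    (subst (_∈ T) (sym ≡α) α∈T) (subst (_∈ T) (sym ≡β) β∈T)
    (subst (λ n → All (_≤ n) T) (sym ≡β) T≤β) (subst₂ _<_ (sym ≡β) (sym ≡γ) β<γ)
    (nextStack-cong (sym ≡α) (sym ≡β) (sym ≡γ) next)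
  where
  β<K = <-trans β<γ γ<K
  α<K = ≤-<-trans (All.lookup T≤β α∈T) β<K
  ≡α = toℕ-fromℕ< α<K
  ≡β = toℕ-fromℕ< β<K
  ≡γ = toℕ-fromℕ< γ<K

step-row : ∀ {K T S} {s : Row K} (st : StepOK (row K T) s) →
           NextStack T (toℕ (a-of st)) (toℕ (b-of st)) (toℕ (c-of st)) S → s ≡ row K S
step-row {K} {T} {S} {s} (a , b , c , a≤b , b<c , _ , _ , _ , _ , _ , _ , _ , below , gap , fresh , beyond)
         next = row-ext s S region
  where
  region : ∀ j → lookup s j ≡ lookup (row K S) j
  region j with toℕ j <? toℕ a
  ... | yes j<a = trans (below j j<a) (sym (row-cong (next-below next a≤b j<a)))
  ... | no j≮a with toℕ j ≤? toℕ b
  ...   | yes j≤b = trans (gap j (≮⇒≥ j≮a) j≤b) (sym (row-∉ (next-gap next (≮⇒≥ j≮a) j≤b)))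
  ...   | no j≰b with toℕ j ≤? toℕ c
  ...     | yes j≤c = trans (fresh j (≰⇒> j≰b) j≤c) (sym (row-∈ (next-fresh next (≰⇒> j≰b) j≤c)))
  ...     | no j≰c =
    trans (beyond j (≰⇒> j≰c)) (sym (row-∉ (next-beyond next (≤-trans a≤b (<⇒≤ b<c)) (≰⇒> j≰c))))

step-a : ∀ {K T S α β γ} (st : StepOK (row K T) (row K S)) → α ∈ T → α ≤ β →
         NextStack T α β γ S → toℕ (a-of st) ≡ α
step-a (a , _ , _ , _ , _ , ra , sa , a-least , _) α∈T α≤β next = ≤-antisym a≤α α≤a
  where
  α≤a = ≮⇒≥ (λ a<α → ∉-row sa (Equivalence.from (next-below next α≤β a<α) (∈-row ra)))
  a≤α = ≮⇒≥ (λ α<a → let α<K = <-trans α<a (toℕ<n a) in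
                         a-least (fromℕ< α<K) (<-fromℕ<ˡ α<K α<a)
                                 (row-∈′ α<K α∈T , row-∉′ α<K (next-gap next ≤-refl α≤β)))

step-b : ∀ {K T β} {s : Row K} (st : StepOK (row K T) s) → β ∈ T → All (_≤ β) T → β < K →
         toℕ (b-of st) ≡ β
step-b (_ , b , _ , _ , _ , _ , _ , _ , rb , b-last , _) β∈T T≤β β<K =
  ≤-antisym (All.lookup T≤β (∈-row rb))
            (≮⇒≥ (λ b<β → true≢false (trans (sym (row-∈′ β<K β∈T))
                                              (b-last (fromℕ< β<K) (<-fromℕ<ʳ β<K b<β)))))

step-c : ∀ {K T S α β γ} (st : StepOK (row K T) (row K S)) → α ≤ β → β < γ → γ < K →
         NextStack T α β γ S → toℕ (c-of st) ≡ γ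
step-c {γ = γ} (_ , _ , c , _ , _ , _ , _ , _ , _ , _ , sc , c-last , _) α≤β β<γ γ<K next =
  ≤-antisym c≤γ γ≤c
  where
  c≤γ : toℕ c ≤ γ
  c≤γ with Equivalence.to next (∈-row sc)
  ... | inj₁ (_ , c≤γ) = c≤γ
  ... | inj₂ (_ , c<α) = <⇒≤ (<-≤-trans c<α (≤-trans α≤β (<⇒≤ β<γ)))
  γ≤c = ≮⇒≥ (λ c<γ → true≢false (trans (sym (row-∈′ γ<K (next-fresh next β<γ ≤-refl)))
                                        (c-last (fromℕ< γ<K) (<-fromℕ<ʳ γ<K c<γ))))

-- Dyck matrices as runs

currentRun : List (ℕ × ℕ) → ℕ → ℕ
currentRun [] m = m
currentRun ((m , _) ∷ _) _ = m

-- N is the first unused column and S the stack below the current x-run.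
mutual
  rows : (K N : ℕ) → List ℕ → (L : List (ℕ × ℕ)) → ℕ → Vec (Row K) (suc (length L))
  rows K N S L m = row K (push N (currentRun L m) S) ∷ laterRows K N S L m

  laterRows : (K N : ℕ) → List ℕ → (L : List (ℕ × ℕ)) → ℕ → Vec (Row K) (length L)
  laterRows K N S [] m = []
  laterRows K N S ((m , d) ∷ L) m′ = rows K (suc m + N) (drop (suc d) (push N m S)) L m′

lastColumn : ℕ → List (ℕ × ℕ) → ℕ → ℕ
lastColumn N [] m = m + N
lastColumn N ((m , _) ∷ L) m′ = lastColumn (suc m + N) L m′

currentRun≤lastColumn : ∀ N L m → currentRun L m + N ≤ lastColumn N L m
currentRun≤lastColumn N [] m = ≤-refl
currentRun≤lastColumn N ((m , _) ∷ L) m′ =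
  ≤-trans (n≤1+n (m + N))
          (≤-trans (m≤n+m (suc m + N) (currentRun L m′)) (currentRun≤lastColumn (suc m + N) L m′))

readRuns : ∀ {K n} → ℕ → List ℕ → ℕ → (rs : Vec (Row K) (suc n)) → AllSteps rs → Runs
readRuns N S m (_ ∷ []) _ = [] , m
readRuns N S m (_ ∷ s ∷ rs) (st , sts) =
  map₁ ((m , d) ∷_) (readRuns (suc m + N) (drop (suc d) T) (toℕ (c-of st) ∸ (suc m + N)) (s ∷ rs) sts)
  where
  T = push N m S
  d = #above (toℕ (a-of st)) T

rows-steps : ∀ {K} N S L m → Descending S → All (_< N) S → ValidRuns (length S) L →
             lastColumn N L m < K → AllSteps (rows K N S L m)
rows-steps N S [] m _ _ _ _ = tt
rows-steps {K} N S ((m , d) ∷ L) m′ desc S<N (d<h , valid) bound =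
  stepOK-rows α∈T (here refl) (push-top m S<N) (m≤n+m (suc m + N) m₂) γ<K (next (m + N) m₂) ,
  rows-steps (suc m + N) (drop (suc d) T) L m′ (proj₁ popped) (proj₂ popped)
             (subst (λ h → ValidRuns h L) (sym (length-pop N m S d)) valid) bound
  where
  T = push N m S
  m₂ = currentRun L m′
  γ<K = ≤-<-trans (currentRun≤lastColumn (suc m + N) L m′) bound
  popped = popped-stack m d desc S<N
  split = pop-depth (push-descending m desc S<N) (subst (d <_) (sym (length-push N m S)) d<h)
  α∈T = proj₁ (proj₂ split)
  next = proj₂ (proj₂ (proj₂ split))

readRuns-rows : ∀ {K} N S L m → Descending S → All (_< N) S → ValidRuns (length S) L →
                lastColumn N L m < K → (sts : AllSteps (rows K N S L m)) →
                readRuns N S (currentRun L m) (rows K N S L m) sts ≡ (L , m)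
readRuns-rows N S [] m _ _ _ _ _ = refl
readRuns-rows {K} N S ((m , d) ∷ L) m′ desc S<N (d<h , valid) bound (st , sts) = begin
  map₁ ((m , d′) ∷_) (readRuns N′ (drop (suc d′) T) m₂′ later sts)
    ≡⟨ cong₂ (λ e n → map₁ ((m , e) ∷_) (readRuns N′ (drop (suc e) T) n later sts)) fall rise ⟩
  map₁ ((m , d) ∷_) (readRuns N′ (drop (suc d) T) m₂ later sts)
    ≡⟨ cong (map₁ ((m , d) ∷_))
            (readRuns-rows N′ (drop (suc d) T) L m′ (proj₁ popped) (proj₂ popped)
                           (subst (λ h → ValidRuns h L) (sym (length-pop N m S d)) valid) bound sts) ⟩
  ((m , d) ∷ L , m′) ∎
  where
  open ≡-Reasoning
  T = push N m S
  N′ = suc m + N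
  m₂ = currentRun L m′
  later = rows K N′ (drop (suc d) T) L m′
  d′ = #above (toℕ (a-of st)) T
  m₂′ = toℕ (c-of st) ∸ N′
  popped = popped-stack m d desc S<N
  γ<K = ≤-<-trans (currentRun≤lastColumn N′ L m′) bound
  split = pop-depth (push-descending m desc S<N) (subst (d <_) (sym (length-push N m S)) d<h)
  α∈T = proj₁ (proj₂ split)
  α≤β = All.lookup (push-top m S<N) α∈T
  next = proj₂ (proj₂ (proj₂ split)) (m + N) m₂
  fall : d′ ≡ d
  fall = trans (cong (λ a → #above a T) (step-a st α∈T α≤β next)) (proj₁ (proj₂ (proj₂ split)))
  rise : m₂′ ≡ m₂
  rise = trans (cong (_∸ N′) (step-c st α≤β (m≤n+m N′ m₂) γ<K next)) (m+n∸n≡m m₂ N′)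

step-shape : ∀ {K N m S} {s : Row K} → Descending S → All (_< N) S → suc m + N ≤ K →
             (st : StepOK (row K (push N m S)) s) →
             let T = push N m S
                 N′ = suc m + N
                 d = #above (toℕ (a-of st)) T
                 m₂ = toℕ (c-of st) ∸ N′
             in d < suc m + length S × suc m₂ + N′ ≤ K × s ≡ row K (push N′ m₂ (drop (suc d) T))
step-shape {K} {N} {m} {S} {s} desc S<N β<K st@(a , b , c , _ , b<c , ra , _) =
  subst (#above (toℕ a) T <_) (length-push N m S) (proj₁ popped) ,
  subst (λ n → suc n ≤ K) (sym m₂+N′≡c) (toℕ<n c) ,
  step-row st (nextStack-cong refl (sym b≡β) m₂+N′≡c (proj₂ popped (m + N) m₂))
  where
  T = push N m S
  N′ = suc m + N
  m₂ = toℕ c ∸ N′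
  popped = pop-entry (push-descending m desc S<N) (∈-row ra)
  b≡β = step-b {s = s} st (here refl) (push-top m S<N) β<K
  m₂+N′≡c : m₂ + N′ ≡ toℕ c
  m₂+N′≡c = m∸n+n≡m (subst (_< toℕ c) b≡β b<c)

Recovers : ∀ {K n} → ℕ → List ℕ → Runs → Vec (Row K) (suc n) → Set
Recovers {K} {n} N S (L , m) rs =
  ValidRuns (length S) L × lastColumn N L m < K ×
  _≡_ {A = Σ ℕ (λ n → Vec (Row K) (suc n))} (length L , rows K N S L m) (n , rs)

readRuns-recovers : ∀ {K n} N S m (rs : Vec (Row K) (suc n)) (sts : AllSteps rs) →
                    Descending S → All (_< N) S → suc m + N ≤ K → head rs ≡ row K (push N m S) →
                    Recovers N S (readRuns N S m rs sts) rs
readRuns-recovers N S m (_ ∷ []) _ _ _ bound refl = tt , bound , refl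
readRuns-recovers {K} N S m (_ ∷ s ∷ rs) (st , sts) desc S<N bound refl =
  (proj₁ shape , subst (λ h → ValidRuns h (proj₁ runs)) (length-pop N m S d) (proj₁ recovered)) ,
  proj₁ (proj₂ recovered) ,
  cong (λ p → suc (proj₁ p) , row K T ∷ proj₂ p) (proj₂ (proj₂ recovered))
  where
  T = push N m S
  d = #above (toℕ (a-of st)) T
  m₂ = toℕ (c-of st) ∸ (suc m + N)
  shape = step-shape {N = N} {m = m} {S = S} {s = s} desc S<N bound st
  popped = popped-stack m d desc S<N
  runs = readRuns (suc m + N) (drop (suc d) T) m₂ (s ∷ rs) sts
  recovered = readRuns-recovers (suc m + N) (drop (suc d) T) m₂ (s ∷ rs) sts (proj₁ popped) (proj₂ popped)
                                (proj₁ (proj₂ shape)) (proj₂ (proj₂ shape))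

∈-push₀⇔ : ∀ {m j} → j ∈ push 0 m [] ⇔ j < suc m
∈-push₀⇔ {m} {j} = mk⇔ first⇒ (Equivalence.from (∈-push⇔ {0} {m} {[]}) ∘ first⇐)
  where
  first⇒ : j ∈ push 0 m [] → j < suc m
  first⇒ j∈ with Equivalence.to (∈-push⇔ {0} {m} {[]}) j∈
  ... | inj₁ (_ , j≤m+0) = s≤s (subst (j ≤_) (+-identityʳ m) j≤m+0)
  ... | inj₂ ()
  first⇐ : j < suc m → _
  first⇐ j<sm = inj₁ (z≤n , subst (j ≤_) (sym (+-identityʳ m)) (s≤s⁻¹ j<sm))

firstRow-push : ∀ {K} m → suc m ≤ K → FirstRowOK (row K (push 0 m []))
firstRow-push m sm≤K =
  suc m , s≤s z≤n , sm≤K ,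
  λ j → Equivalence.to ∈-push₀⇔ ∘ ∈-row {S = push 0 m []} , row-∈ ∘ Equivalence.from ∈-push₀⇔

firstRow-row : ∀ {K} m (r : Row K) →
               (∀ j → (lookup r j ≡ true → toℕ j < suc m) × (toℕ j < suc m → lookup r j ≡ true)) →
               r ≡ row K (push 0 m [])
firstRow-row m r spec = row-ext r (push 0 m []) entry
  where
  entry : ∀ j → lookup r j ≡ lookup (row _ (push 0 m [])) j
  entry j with toℕ j <? suc m
  ... | yes j<sm = trans (proj₂ (spec j) j<sm) (sym (row-∈ (Equivalence.from ∈-push₀⇔ j<sm)))
  ... | no j≮sm = trans (¬-not (j≮sm ∘ proj₁ (spec j))) (sym (row-∉ (j≮sm ∘ Equivalence.to ∈-push₀⇔)))

-- The second component is the number of trailing zero columns.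
matrixOf : Runs × ℕ → RawMatrix
matrixOf ((L , m) , t) = length L , lastColumn 0 L m + t , rows (suc (lastColumn 0 L m + t)) 0 [] L m

matrixOf-dyck : ∀ p → ValidPadded p → IsDyckMatrix (matrixOf p)
matrixOf-dyck ((L , m) , t) valid =
  firstRow-push (currentRun L m) (s≤s (≤-trans (≤-trans (m≤m+n _ 0) (currentRun≤lastColumn 0 L m)) (m≤m+n _ t))) ,
  rows-steps 0 [] L m [] [] valid (s≤s (m≤m+n _ t))

matrixOf-≡ : ∀ {L m t n k} {rs : Vec (Row (suc k)) (suc n)} → lastColumn 0 L m + t ≡ k →
             _≡_ {A = Σ ℕ (λ n → Vec (Row (suc k)) (suc n))} (length L , rows (suc k) 0 [] L m) (n , rs) →
             matrixOf ((L , m) , t) ≡ (n , k , rs)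
matrixOf-≡ refl eq = cong (λ p → proj₁ p , _ , proj₂ p) eq

unmatrix : DyckMatrix → Runs × ℕ
unmatrix ((n , k , r ∷ rs) , (h , _) , sts) = runs , k ∸ lastColumn 0 (proj₁ runs) (proj₂ runs)
  where
  runs = readRuns 0 [] (pred h) (r ∷ rs) sts

unmatrix-sound : ∀ M → ValidPadded (unmatrix M) × matrixOf (unmatrix M) ≡ proj₁ M
unmatrix-sound ((n , k , r ∷ rs) , (zero , () , _) , sts)
unmatrix-sound ((n , k , r ∷ rs) , (suc m , _ , sm≤sk , spec) , sts) =
  proj₁ recovered , matrixOf-≡ (m+[n∸m]≡n (s≤s⁻¹ (proj₁ (proj₂ recovered)))) (proj₂ (proj₂ recovered))
  where
  recovered = readRuns-recovers 0 [] m (r ∷ rs) sts [] [] (subst (_≤ suc k) (sym (+-identityʳ (suc m))) sm≤sk)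
                                (firstRow-row m r spec)

unmatrix-matrixOf : ∀ p (valid : ValidPadded p) → unmatrix (matrixOf p , matrixOf-dyck p valid) ≡ p
unmatrix-matrixOf ((L , m) , t) valid =
  cong₂ _,_ runs≡ (trans (cong (λ r → c + t ∸ lastColumn 0 (proj₁ r) (proj₂ r)) runs≡) (m+n∸m≡n c t))
  where
  c = lastColumn 0 L m
  runs≡ = readRuns-rows 0 [] L m [] [] valid (s≤s (m≤m+n c t)) (proj₂ (matrixOf-dyck ((L , m) , t) valid))

dyckFrom-word : ∀ (w : DyckWord) → DyckFrom 0 (proj₁ w)
dyckFrom-word (w , dyck) = balanced⇒dyckFrom 0 w dyck

toMatrix : DyckWord → DyckMatrix
toMatrix (w , dyck) =
  matrixOf (pad (parse w)) , matrixOf-dyck (pad (parse w)) (pad-valid (parse w) (proj₁ (parse-sound w (dyckFrom-word (w , dyck)))))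

toWord : DyckMatrix → DyckWord
toWord M =
  wordOf (unpad (unmatrix M)) ,
  dyckFrom⇒balanced 0 _ (wordOf-dyckFrom (unpad (unmatrix M)) (unpad-valid (unmatrix M) (proj₁ (unmatrix-sound M))))

toWord-toMatrix : ∀ w → proj₁ (toWord (toMatrix w)) ≡ proj₁ w
toWord-toMatrix (w , dyck) = begin
  wordOf (unpad (unmatrix (toMatrix (w , dyck)))) ≡⟨ cong (wordOf ∘ unpad) (unmatrix-matrixOf (pad (parse w)) _) ⟩
  wordOf (unpad (pad (parse w)))                  ≡⟨ cong wordOf (unpad-pad (parse w)) ⟩
  wordOf (parse w)                                ≡⟨ proj₂ (parse-sound w (dyckFrom-word (w , dyck))) ⟩
  w                                               ∎
  where open ≡-Reasoning

toMatrix-toWord : ∀ M → proj₁ (toMatrix (toWord M)) ≡ proj₁ M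
toMatrix-toWord M = begin
  matrixOf (pad (parse (wordOf (unpad (unmatrix M))))) ≡⟨ cong (matrixOf ∘ pad) (parse-wordOf (unpad (unmatrix M))) ⟩
  matrixOf (pad (unpad (unmatrix M)))                  ≡⟨ cong matrixOf (pad-unpad (unmatrix M)) ⟩
  matrixOf (unmatrix M)                                ≡⟨ proj₂ (unmatrix-sound M) ⟩
  proj₁ M                                              ∎
  where open ≡-Reasoning

theorem1 : Σ[ f ∈ (DyckWord → DyckMatrix) ] Σ[ g ∈ (DyckMatrix → DyckWord) ]
    ((∀ (w : DyckWord) → proj₁ (g (f w)) ≡ proj₁ w) × (∀ (M : DyckMatrix) → proj₁ (f (g M)) ≡ proj₁ M))
theorem1 = toMatrix , toWord , toWord-toMatrix , toMatrix-toWord
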